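{- Any single-pass streaming algorithm that decides, with probability $2/3$, whether $\mathrm{OPT}>0$ for $\textup{Min-SAT}$ on $n$ variables must use $\Omega(n)$ bits of space.
   Context: $\textup{Min-SAT}$: given clauses over Boolean variables $x_1,\dots,x_n$, each clause a disjunction of literals, find an assignment minimizing the number of satisfied clauses. $\mathrm{OPT}$ is this minimum. The clauses arrive one at a time in a stream, and the algorithm makes a single pass. -}

module Defs where

open import Data.Nat using (ℕ; zero; suc; _+_; _*_; _^_; _≤_; _⊓_; _<ᵇ_)
open import Data.Bool using (Bool; true; false; not; _∨_; _xor_)
open import Data.Fin using (Fin)
open import Data.Vec using (Vec; []; _∷_; lookup; replicate)
open import Data.List using (List; []; _∷_; _++_; map; foldr; foldl; allFin)
open import Data.Product using (_×_; _,_)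

-- A literal over variables x_0..x_{n-1}: (variable index, polarity);
-- (i , true) is x_i, (i , false) is ¬x_i.
Literal : ℕ → Set
Literal n = Fin n × Bool

Clause : ℕ → Set
Clause n = List (Literal n)

Assignment : ℕ → Set
Assignment n = Vec Bool n

litVal : {n : ℕ} → Assignment n → Literal n → Bool
litVal a (i , true)  = lookup a i
litVal a (i , false) = not (lookup a i)

clauseSat : {n : ℕ} → Assignment n → Clause n → Bool
clauseSat a []       = false
clauseSat a (l ∷ ls) = litVal a l ∨ clauseSat a ls

countTrue : List Bool → ℕ
countTrue []           = 0
countTrue (true ∷ bs)  = suc (countTrue bs)
countTrue (false ∷ bs) = countTrue bs

numSat : {n : ℕ} → Assignment n → List (Clause n) → ℕ
numSat a cs = countTrue (map (clauseSat a) cs)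

allAssignments : (n : ℕ) → List (Assignment n)
allAssignments zero    = [] ∷ []
allAssignments (suc n) =
  map (true ∷_) (allAssignments n) ++ map (false ∷_) (allAssignments n)

OPT : (n : ℕ) → List (Clause n) → ℕ
OPT n cs = foldr (λ a m → numSat a cs ⊓ m)
                 (numSat (replicate n false) cs) (allAssignments n)

optPositive : (n : ℕ) → List (Clause n) → Bool
optPositive n cs = 0 <ᵇ OPT n cs

-- Randomness is a uniformly random seed r in Fin (suc seeds)
-- (an arbitrary finite uniform sample space), chosen before the stream and
-- available for free at every step.
record StreamAlg (n s : ℕ) : Set where
  field
    seeds : ℕ
    init  : Fin (suc seeds) → Fin (2 ^ s)
    step  : Fin (suc seeds) → Fin (2 ^ s) → Clause n → Fin (2 ^ s)
    out   : Fin (suc seeds) → Fin (2 ^ s) → Bool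

  run : Fin (suc seeds) → List (Clause n) → Fin (2 ^ s)
  run r cs = foldl (step r) (init r) cs

  successes : List (Clause n) → ℕ
  successes cs =
    countTrue (map (λ r → not (out r (run r cs) xor optPositive n cs))
                   (allFin (suc seeds)))

Decides : {n s : ℕ} → StreamAlg n s → Set
Decides {n} A = (cs : List (Clause n)) →
  2 * suc (StreamAlg.seeds A) ≤ 3 * StreamAlg.successes A cs

-- Streaming Min-SAT decides INDEX: Alice's bits x are fed as the unit clauses x_k (for x_k = 1),
-- then Bob's index i as the clause ¬x_i; OPT > 0 exactly when x_i = 1.  For a fixed seed the
-- memory after Alice's part is one of 2^s states, and from each state the algorithm's answers
-- to all n possible queries form a guess y of x.  Since Σ_x 2^(agreement y x) = 3^n for every
-- y, the states give Σ_x 2^(agreement) ≤ 2^s·3^n; but correctness 2/3 gives, for the best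
-- seed, average agreement ≥ 2n/3, hence by convexity Σ_x 2^(agreement) ≥ 2^n·2^(2n/3).
-- So 2^s ≥ (2^(5/3)/3)^n, i.e. s = Ω(n).
module Submission where

open import Defs
open import Data.Nat
open import Data.Nat.Properties
open import Data.Nat.DivMod using (_/_; _%_; m≡m%n+[m/n]*n; m%n<n)
open import Data.Nat.Tactic.RingSolver using (solve-∀)
open import Data.Bool using (Bool; true; false; not; _∨_; _xor_; if_then_else_)
open import Data.Fin using (Fin; zero; suc)
open import Data.Vec as Vec using (Vec; []; _∷_; lookup; tabulate)
open import Data.Vec.Properties using (lookup-map; lookup∘tabulate)
open import Data.List as List using (List; []; _∷_; _++_; length; foldr; allFin)
open import Data.List.Properties using (foldl-++; length-++; length-map; length-tabulate; map-tabulate)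
open import Data.List.Membership.Propositional using (_∈_)
open import Data.List.Membership.Propositional.Properties
  using (∈-++⁺ˡ; ∈-++⁺ʳ; ∈-++⁻; ∈-map⁺; ∈-map⁻; ∈-allFin)
open import Data.List.Relation.Unary.Any using (here; there)
open import Data.Product using (Σ; ∃-syntax; _,_)
open import Data.Sum using (inj₁; inj₂)
open import Function using (_∘_; id)
open import Relation.Binary.PropositionalEquality
open import Relation.Nullary using (yes; no; contradiction)

private
  variable
    A B : Set
    n : ℕ

∑ : List A → (A → ℕ) → ℕ
∑ []       f = 0
∑ (x ∷ xs) f = f x + ∑ xs f

infix 5 ∑
syntax ∑ xs (λ x → t) = ∑[ x ∈ xs ] t

∑-cong : (xs : List A) {f g : A → ℕ} → (∀ x → f x ≡ g x) → ∑ xs f ≡ ∑ xs g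
∑-cong []       f≡g = refl
∑-cong (x ∷ xs) f≡g = cong₂ _+_ (f≡g x) (∑-cong xs f≡g)

∑-mono-≤ : (xs : List A) {f g : A → ℕ} → (∀ x → f x ≤ g x) → ∑ xs f ≤ ∑ xs g
∑-mono-≤ []       f≤g = z≤n
∑-mono-≤ (x ∷ xs) f≤g = +-mono-≤ (f≤g x) (∑-mono-≤ xs f≤g)

∑-distrib-+ : (xs : List A) (f g : A → ℕ) → ∑[ x ∈ xs ] (f x + g x) ≡ ∑ xs f + ∑ xs g
∑-distrib-+ []       f g = refl
∑-distrib-+ (x ∷ xs) f g = begin
  f x + g x + (∑[ x ∈ xs ] (f x + g x)) ≡⟨ cong (f x + g x +_) (∑-distrib-+ xs f g) ⟩
  f x + g x + (∑ xs f + ∑ xs g)       ≡⟨ +-+-swap (f x) (g x) (∑ xs f) (∑ xs g) ⟩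
  f x + ∑ xs f + (g x + ∑ xs g)       ∎
  where
  open ≡-Reasoning
  +-+-swap : ∀ a b c d → a + b + (c + d) ≡ a + c + (b + d)
  +-+-swap = solve-∀

*-distribˡ-∑ : (k : ℕ) (xs : List A) (f : A → ℕ) → k * ∑ xs f ≡ ∑[ x ∈ xs ] k * f x
*-distribˡ-∑ k []       f = *-zeroʳ k
*-distribˡ-∑ k (x ∷ xs) f = trans (*-distribˡ-+ k (f x) (∑ xs f)) (cong (k * f x +_) (*-distribˡ-∑ k xs f))

∑-const : (xs : List A) (k : ℕ) → ∑[ x ∈ xs ] k ≡ length xs * k
∑-const []       k = refl
∑-const (x ∷ xs) k = cong (k +_) (∑-const xs k)

∑-++ : (xs ys : List A) (f : A → ℕ) → ∑ (xs ++ ys) f ≡ ∑ xs f + ∑ ys f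
∑-++ []       ys f = refl
∑-++ (x ∷ xs) ys f = trans (cong (f x +_) (∑-++ xs ys f)) (sym (+-assoc (f x) _ _))

∑-map : (g : A → B) (xs : List A) (f : B → ℕ) → ∑ (List.map g xs) f ≡ ∑ xs (f ∘ g)
∑-map g []       f = refl
∑-map g (x ∷ xs) f = cong (f (g x) +_) (∑-map g xs f)

∑-comm : (xs : List A) (ys : List B) (f : A → B → ℕ) →
  ∑[ x ∈ xs ] ∑ ys (f x) ≡ ∑[ y ∈ ys ] ∑[ x ∈ xs ] f x y
∑-comm []       ys f = sym (trans (∑-const ys 0) (*-zeroʳ (length ys)))
∑-comm (x ∷ xs) ys f =
  trans (cong (∑ ys (f x) +_) (∑-comm xs ys f)) (sym (∑-distrib-+ ys (f x) (λ y → ∑[ x ∈ xs ] f x y)))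

≤-∑ : (f : A → ℕ) {x : A} {xs : List A} → x ∈ xs → f x ≤ ∑ xs f
≤-∑ f {xs = x ∷ xs} (here refl) = m≤m+n (f x) (∑ xs f)
≤-∑ f {xs = y ∷ xs} (there x∈xs) = ≤-trans (≤-∑ f x∈xs) (m≤n+m (∑ xs f) (f y))

length-allFin : ∀ n → length (allFin n) ≡ n
length-allFin n = length-tabulate id

∑-allFin-suc : (f : Fin (suc n) → ℕ) → ∑ (allFin (suc n)) f ≡ f zero + ∑ (allFin n) (f ∘ suc)
∑-allFin-suc {n} f = cong (f zero +_) (begin
  ∑ (List.tabulate suc) f           ≡⟨ cong (λ is → ∑ is f) (sym (map-tabulate id suc)) ⟩
  ∑ (List.map suc (allFin n)) f     ≡⟨ ∑-map suc (allFin n) f ⟩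
  ∑ (allFin n) (f ∘ suc)            ∎)
  where open ≡-Reasoning

≥-average : (f : A → ℕ) (x : A) (xs : List A) {c : ℕ} →
  length (x ∷ xs) * c ≤ ∑ (x ∷ xs) f → ∃[ y ] c ≤ f y
≥-average f x []       {c} h = x , +-cancelʳ-≤ 0 c (f x) h
≥-average f x (y ∷ ys) {c} h with c ≤? f x
... | yes c≤fx = x , c≤fx
... | no  c≰fx = ≥-average f y ys
  (+-cancelˡ-≤ (f x) _ _ (≤-trans (+-monoˡ-≤ _ (<⇒≤ (≰⇒> c≰fx))) h))

suc-≤-2^ : ∀ a → suc a ≤ 2 ^ a
suc-≤-2^ zero    = ≤-refl
suc-≤-2^ (suc a) = +-mono-≤ (m^n>0 2 a) (≤-trans (suc-≤-2^ a) (m≤m+n (2 ^ a) 0))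

-- The chord of 2^x over [j, j + 1] lies below 2^x at every integer.
2^-chord : ∀ a j → 2 ^ j * suc a ≤ 2 ^ a + j * 2 ^ j
2^-chord a       zero    = ≤-trans (≤-reflexive (+-identityʳ (suc a))) (≤-trans (suc-≤-2^ a) (m≤m+n (2 ^ a) 0))
2^-chord zero    (suc j) = ≤-trans (≤-reflexive (*-identityʳ (2 ^ suc j))) (≤-trans (m≤m+n _ _) (n≤1+n _))
2^-chord (suc a) (suc j) = begin
  2 * P * suc (suc a)       ≡⟨ e₁ P a ⟩
  2 * (P * suc a) + 2 * P   ≤⟨ +-monoˡ-≤ (2 * P) (*-monoʳ-≤ 2 (2^-chord a j)) ⟩
  2 * (Q + j * P) + 2 * P   ≡⟨ e₂ P Q j ⟩
  2 * Q + suc j * (2 * P)   ∎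
  where
  open ≤-Reasoning
  P = 2 ^ j
  Q = 2 ^ a
  e₁ : ∀ P a → 2 * P * suc (suc a) ≡ 2 * (P * suc a) + 2 * P
  e₁ = solve-∀
  e₂ : ∀ P Q j → 2 * (Q + j * P) + 2 * P ≡ 2 * Q + suc j * (2 * P)
  e₂ = solve-∀

2^-jensen : (xs : List A) (f : A → ℕ) (j : ℕ) →
  length xs * j ≤ ∑ xs f → length xs * 2 ^ j ≤ ∑[ x ∈ xs ] 2 ^ f x
2^-jensen xs f j mean≥j = +-cancelʳ-≤ (P * F) (L * P) W (begin
  L * P + P * F                  ≡⟨ e₁ L P F ⟩
  P * (L * 1 + F)                ≡⟨ cong (P *_) (sym ∑-suc) ⟩
  P * (∑[ x ∈ xs ] suc (f x))    ≡⟨ *-distribˡ-∑ P xs (suc ∘ f) ⟩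
  ∑[ x ∈ xs ] P * suc (f x)      ≤⟨ ∑-mono-≤ xs (λ x → 2^-chord (f x) j) ⟩
  ∑[ x ∈ xs ] (2 ^ f x + j * P)  ≡⟨ ∑-distrib-+ xs (λ x → 2 ^ f x) (λ _ → j * P) ⟩
  W + (∑[ x ∈ xs ] j * P)        ≡⟨ cong (W +_) (∑-const xs (j * P)) ⟩
  W + L * (j * P)                ≡⟨ cong (W +_) (e₂ L j P) ⟩
  W + P * (L * j)                ≤⟨ +-monoʳ-≤ W (*-monoʳ-≤ P mean≥j) ⟩
  W + P * F                      ∎)
  where
  open ≤-Reasoning
  L = length xs
  P = 2 ^ j
  F = ∑ xs f
  W = ∑[ x ∈ xs ] 2 ^ f x
  ∑-suc : ∑[ x ∈ xs ] suc (f x) ≡ L * 1 + F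
  ∑-suc = trans (∑-distrib-+ xs (λ _ → 1) f) (cong (_+ F) (∑-const xs 1))
  e₁ : ∀ L P F → L * P + P * F ≡ P * (L * 1 + F)
  e₁ = solve-∀
  e₂ : ∀ L j P → L * (j * P) ≡ P * (L * j)
  e₂ = solve-∀

∈-allAssignments : (a : Assignment n) → a ∈ allAssignments n
∈-allAssignments []          = here refl
∈-allAssignments (true ∷ a)  = ∈-++⁺ˡ (∈-map⁺ (true ∷_) (∈-allAssignments a))
∈-allAssignments (false ∷ a) =
  ∈-++⁺ʳ (List.map (true ∷_) (allAssignments _)) (∈-map⁺ (false ∷_) (∈-allAssignments a))

numSat-positive : (a : Assignment n) {c : Clause n} {cs : List (Clause n)} →
  c ∈ cs → clauseSat a c ≡ true → 0 < numSat a cs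
numSat-positive a {cs = c ∷ cs} (here refl) sat rewrite sat = s≤s z≤n
numSat-positive a {cs = c ∷ cs} (there c∈cs) sat with clauseSat a c
... | true  = s≤s z≤n
... | false = numSat-positive a c∈cs sat

numSat-zero : (a : Assignment n) (cs : List (Clause n)) →
  (∀ {c} → c ∈ cs → clauseSat a c ≡ false) → numSat a cs ≡ 0
numSat-zero a []       unsat = refl
numSat-zero a (c ∷ cs) unsat rewrite unsat (here refl) = numSat-zero a cs (unsat ∘ there)

OPT-positive : (cs : List (Clause n)) → (∀ a → 0 < numSat a cs) → 0 < OPT n cs
OPT-positive {n} cs sat = go (allAssignments n)
  where
  go : (as : List (Assignment n)) →
    0 < foldr (λ a m → numSat a cs ⊓ m) (numSat (Vec.replicate n false) cs) as
  go []       = sat _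
  go (a ∷ as) = ⊓-glb (sat a) (go as)

OPT-zero : (cs : List (Clause n)) (a : Assignment n) → numSat a cs ≡ 0 → OPT n cs ≡ 0
OPT-zero {n} cs a unsat = go (∈-allAssignments a)
  where
  go : {as : List (Assignment n)} → a ∈ as →
    foldr (λ a m → numSat a cs ⊓ m) (numSat (Vec.replicate n false) cs) as ≡ 0
  go (here refl)            rewrite unsat = refl
  go {as = b ∷ _} (there a∈as) rewrite go a∈as = ⊓-zeroʳ (numSat b cs)

-- The reduction from INDEX

-- The empty clause stands for x_k = 0: it is never satisfied.
bitClause : Vec Bool n → Fin n → Clause n
bitClause x k = if lookup x k then (k , true) ∷ [] else []

encode : Vec Bool n → List (Clause n)
encode {n} x = List.map (bitClause x) (allFin n)

query : Fin n → Clause n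
query i = (i , false) ∷ []

indexStream : Vec Bool n → Fin n → List (Clause n)
indexStream x i = encode x ++ query i ∷ []

OPT-indexStream-positive : (x : Vec Bool n) (i : Fin n) → lookup x i ≡ true → 0 < OPT n (indexStream x i)
OPT-indexStream-positive x i xᵢ = OPT-positive (indexStream x i) satisfiesSome
  where
  satisfiesSome : ∀ a → 0 < numSat a (indexStream x i)
  satisfiesSome a with lookup a i in aᵢ
  ... | true  = numSat-positive a (∈-++⁺ˡ (∈-map⁺ (bitClause x) (∈-allFin i)))
                  (subst (λ c → clauseSat a c ≡ true) (cong (λ b → if b then _ else []) (sym xᵢ))
                    (cong (_∨ false) aᵢ))
  ... | false = numSat-positive a (∈-++⁺ʳ (encode x) (here refl)) (cong (λ b → not b ∨ false) aᵢ)

OPT-indexStream-zero : (x : Vec Bool n) (i : Fin n) → lookup x i ≡ false → OPT n (indexStream x i) ≡ 0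
OPT-indexStream-zero {n} x i xᵢ = OPT-zero (indexStream x i) x̄ (numSat-zero x̄ (indexStream x i) unsat)
  where
  x̄ : Assignment n
  x̄ = Vec.map not x
  x̄-flips : ∀ k → lookup x̄ k ≡ not (lookup x k)
  x̄-flips k = lookup-map k not x
  unsat : ∀ {c} → c ∈ indexStream x i → clauseSat x̄ c ≡ false
  unsat c∈ with ∈-++⁻ (encode x) c∈
  unsat c∈ | inj₂ (here refl) = cong (λ b → not b ∨ false) (trans (x̄-flips i) (cong not xᵢ))
  unsat c∈ | inj₁ c∈encode with ∈-map⁻ (bitClause x) c∈encode
  ... | k , _ , refl with lookup x k in xₖ
  ...   | true  = cong (_∨ false) (trans (x̄-flips k) (cong not xₖ))
  ...   | false = refl

optPositive-indexStream : (x : Vec Bool n) (i : Fin n) → optPositive n (indexStream x i) ≡ lookup x i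
optPositive-indexStream x i with lookup x i in xᵢ
... | true  = 0<⇒0<ᵇ (OPT-indexStream-positive x i xᵢ)
  where
  0<⇒0<ᵇ : {k : ℕ} → 0 < k → (0 <ᵇ k) ≡ true
  0<⇒0<ᵇ (s≤s _) = refl
... | false = cong (0 <ᵇ_) (OPT-indexStream-zero x i xᵢ)

indicator : Bool → ℕ
indicator true  = 1
indicator false = 0

countTrue-map : (p : A → Bool) (xs : List A) → countTrue (List.map p xs) ≡ ∑[ x ∈ xs ] indicator (p x)
countTrue-map p []       = refl
countTrue-map p (x ∷ xs) with p x
... | true  = cong suc (countTrue-map p xs)
... | false = countTrue-map p xs

agree : Bool → Bool → Bool
agree b c = not (b xor c)

agreement : Vec Bool n → Vec Bool n → ℕ
agreement []      []      = 0
agreement (b ∷ y) (c ∷ x) = indicator (agree b c) + agreement y x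

∑-agree-lookup : (y x : Vec Bool n) →
  ∑[ i ∈ allFin n ] indicator (agree (lookup y i) (lookup x i)) ≡ agreement y x
∑-agree-lookup []      []      = refl
∑-agree-lookup (b ∷ y) (c ∷ x) =
  trans (∑-allFin-suc (λ i → indicator (agree (lookup (b ∷ y) i) (lookup (c ∷ x) i))))
        (cong (indicator (agree b c) +_) (∑-agree-lookup y x))

length-allAssignments : ∀ n → length (allAssignments n) ≡ 2 ^ n
length-allAssignments zero    = refl
length-allAssignments (suc n) = begin
  length (List.map (true ∷_) As ++ List.map (false ∷_) As)  ≡⟨ length-++ (List.map (true ∷_) As) ⟩
  length (List.map (true ∷_) As) + length (List.map (false ∷_) As)
    ≡⟨ cong₂ _+_ (length-map (true ∷_) As) (length-map (false ∷_) As) ⟩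
  length As + length As                                      ≡⟨ cong (λ k → k + k) (length-allAssignments n) ⟩
  2 ^ n + 2 ^ n                                              ≡⟨ cong (2 ^ n +_) (sym (+-identityʳ (2 ^ n))) ⟩
  2 ^ suc n                                                  ∎
  where
  open ≡-Reasoning
  As = allAssignments n

-- Each coordinate contributes a factor 2^1 + 2^0 = 3.
∑-2^agreement : (y : Vec Bool n) → ∑[ x ∈ allAssignments n ] 2 ^ agreement y x ≡ 3 ^ n
∑-2^agreement {zero}  []      = refl
∑-2^agreement {suc n} (b ∷ y) = begin
  ∑ (List.map (true ∷_) As ++ List.map (false ∷_) As) (2^agreement (b ∷ y))
    ≡⟨ ∑-++ (List.map (true ∷_) As) _ _ ⟩
  ∑ (List.map (true ∷_) As) (2^agreement (b ∷ y)) + ∑ (List.map (false ∷_) As) (2^agreement (b ∷ y))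
    ≡⟨ cong₂ _+_ (∑-map (true ∷_) As _) (∑-map (false ∷_) As _) ⟩
  (∑[ x ∈ As ] 2 ^ (indicator (agree b true) + agreement y x)) +
  (∑[ x ∈ As ] 2 ^ (indicator (agree b false) + agreement y x))
    ≡⟨ by-first-bit b ⟩
  3 ^ suc n ∎
  where
  open ≡-Reasoning
  As = allAssignments n
  2^agreement : Vec Bool (suc n) → Vec Bool (suc n) → ℕ
  2^agreement y x = 2 ^ agreement y x
  doubled : ∑[ x ∈ As ] 2 * 2 ^ agreement y x ≡ 2 * 3 ^ n
  doubled = trans (sym (*-distribˡ-∑ 2 As (λ x → 2 ^ agreement y x))) (cong (2 *_) (∑-2^agreement y))
  by-first-bit : ∀ b →
    (∑[ x ∈ As ] 2 ^ (indicator (agree b true) + agreement y x)) +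
    (∑[ x ∈ As ] 2 ^ (indicator (agree b false) + agreement y x)) ≡ 3 ^ suc n
  by-first-bit true  rewrite doubled | ∑-2^agreement y = +-comm (2 * 3 ^ n) (3 ^ n)
  by-first-bit false rewrite doubled | ∑-2^agreement y = refl

∑-2^agreement-≤ : {k : ℕ} (message : Vec Bool n → Fin k) (guess : Fin k → Vec Bool n) →
  ∑[ x ∈ allAssignments n ] 2 ^ agreement (guess (message x)) x ≤ k * 3 ^ n
∑-2^agreement-≤ {n} {k} message guess = begin
  ∑[ x ∈ Xs ] g x (message x)       ≤⟨ ∑-mono-≤ Xs (λ x → ≤-∑ (g x) (∈-allFin (message x))) ⟩
  ∑[ x ∈ Xs ] ∑ Ms (g x)            ≡⟨ ∑-comm Xs Ms g ⟩
  ∑[ m ∈ Ms ] ∑[ x ∈ Xs ] g x m     ≡⟨ ∑-cong Ms (λ m → ∑-2^agreement (guess m)) ⟩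
  ∑[ m ∈ Ms ] 3 ^ n                 ≡⟨ ∑-const Ms (3 ^ n) ⟩
  length Ms * 3 ^ n                 ≡⟨ cong (_* 3 ^ n) (length-allFin k) ⟩
  k * 3 ^ n                         ∎
  where
  open ≤-Reasoning
  Xs = allAssignments n
  Ms = allFin k
  g : Vec Bool n → Fin k → ℕ
  g x m = 2 ^ agreement (guess m) x

-- A streaming algorithm as a one-way protocol for INDEX

module _ {n s : ℕ} (𝒜 : StreamAlg n s) where
  open StreamAlg 𝒜

  private
    Seed = Fin (suc seeds)
    Seeds = allFin (suc seeds)
    Xs = allAssignments n
    Is = allFin n

  memory : Seed → Vec Bool n → Fin (2 ^ s)
  memory r x = run r (encode x)

  guess : Seed → Fin (2 ^ s) → Vec Bool n
  guess r m = tabulate (λ i → out r (step r m (query i)))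

  score : Seed → Vec Bool n → ℕ
  score r x = agreement (guess r (memory r x)) x

  successes-indexStream : (x : Vec Bool n) (i : Fin n) →
    successes (indexStream x i) ≡ ∑[ r ∈ Seeds ] indicator (agree (lookup (guess r (memory r x)) i) (lookup x i))
  successes-indexStream x i = trans (countTrue-map _ Seeds) (∑-cong Seeds λ r → cong indicator
    (cong₂ agree
      (trans (cong (out r) (foldl-++ (step r) (init r) (encode x) (query i ∷ [])))
             (sym (lookup∘tabulate (λ i → out r (step r (memory r x) (query i))) i)))
      (optPositive-indexStream x i)))

  ∑-successes :
    ∑[ x ∈ Xs ] ∑[ i ∈ Is ] successes (indexStream x i) ≡ ∑[ r ∈ Seeds ] ∑[ x ∈ Xs ] score r x
  ∑-successes = begin
    ∑[ x ∈ Xs ] ∑[ i ∈ Is ] successes (indexStream x i)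
      ≡⟨ ∑-cong Xs (λ x → ∑-cong Is (successes-indexStream x)) ⟩
    ∑[ x ∈ Xs ] ∑[ i ∈ Is ] ∑[ r ∈ Seeds ] correct r x i
      ≡⟨ ∑-cong Xs (λ x → ∑-comm Is Seeds (λ i r → correct r x i)) ⟩
    ∑[ x ∈ Xs ] ∑[ r ∈ Seeds ] ∑[ i ∈ Is ] correct r x i
      ≡⟨ ∑-comm Xs Seeds (λ x r → ∑[ i ∈ Is ] correct r x i) ⟩
    ∑[ r ∈ Seeds ] ∑[ x ∈ Xs ] ∑[ i ∈ Is ] correct r x i
      ≡⟨ ∑-cong Seeds (λ r → ∑-cong Xs (λ x → ∑-agree-lookup (guess r (memory r x)) x)) ⟩
    ∑[ r ∈ Seeds ] ∑[ x ∈ Xs ] score r x ∎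
    where
    open ≡-Reasoning
    correct : Seed → Vec Bool n → Fin n → ℕ
    correct r x i = indicator (agree (lookup (guess r (memory r x)) i) (lookup x i))

  best-seed : Decides 𝒜 → ∃[ r ] 2 * (2 ^ n * n) ≤ 3 * ∑ Xs (score r)
  best-seed decides = ≥-average (λ r → 3 * ∑ Xs (score r)) zero (List.tabulate suc) (begin
    length Seeds * (2 * (2 ^ n * n))                  ≡⟨ cong (_* (2 * (2 ^ n * n))) (length-allFin N) ⟩
    N * (2 * (2 ^ n * n))                             ≡⟨ reorder N (2 ^ n) n ⟩
    2 ^ n * (n * (2 * N))                             ≡⟨ sym (cong₂ (λ a b → a * (b * (2 * N)))
                                                          (length-allAssignments n) (length-allFin n)) ⟩
    length Xs * (length Is * (2 * N))                 ≡⟨ sym (∑-const-const Xs Is (2 * N)) ⟩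
    ∑[ x ∈ Xs ] ∑[ i ∈ Is ] 2 * N                     ≤⟨ ∑-mono-≤ Xs (λ x → ∑-mono-≤ Is (λ i → decides (indexStream x i))) ⟩
    ∑[ x ∈ Xs ] ∑[ i ∈ Is ] 3 * successes (indexStream x i)
      ≡⟨ ∑-cong Xs (λ x → sym (*-distribˡ-∑ 3 Is _)) ⟩
    ∑[ x ∈ Xs ] 3 * (∑[ i ∈ Is ] successes (indexStream x i))
      ≡⟨ sym (*-distribˡ-∑ 3 Xs _) ⟩
    3 * (∑[ x ∈ Xs ] ∑[ i ∈ Is ] successes (indexStream x i))
      ≡⟨ cong (3 *_) ∑-successes ⟩
    3 * (∑[ r ∈ Seeds ] ∑[ x ∈ Xs ] score r x)        ≡⟨ *-distribˡ-∑ 3 Seeds (λ r → ∑ Xs (score r)) ⟩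
    ∑[ r ∈ Seeds ] 3 * ∑ Xs (score r)                 ∎)
    where
    open ≤-Reasoning
    N = suc seeds
    reorder : ∀ N P n → N * (2 * (P * n)) ≡ P * (n * (2 * N))
    reorder = solve-∀
    ∑-const-const : (xs : List A) (ys : List B) (k : ℕ) → ∑[ x ∈ xs ] ∑[ y ∈ ys ] k ≡ length xs * (length ys * k)
    ∑-const-const xs ys k = trans (∑-cong xs (λ _ → ∑-const ys k)) (∑-const xs _)

  space-lower-bound : Decides 𝒜 → (j : ℕ) → 3 * j ≤ 2 * n → 2 ^ j * 2 ^ n ≤ 2 ^ s * 3 ^ n
  space-lower-bound decides j 3j≤2n with best-seed decides
  ... | r , good = begin
    2 ^ j * 2 ^ n                  ≡⟨ *-comm (2 ^ j) (2 ^ n) ⟩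
    2 ^ n * 2 ^ j                  ≡⟨ cong (_* 2 ^ j) (sym (length-allAssignments n)) ⟩
    length Xs * 2 ^ j              ≤⟨ 2^-jensen Xs (score r) j (≤-trans (≤-reflexive (cong (_* j) (length-allAssignments n))) mean≥j) ⟩
    ∑[ x ∈ Xs ] 2 ^ score r x      ≤⟨ ∑-2^agreement-≤ (memory r) (guess r) ⟩
    2 ^ s * 3 ^ n                  ∎
    where
    open ≤-Reasoning
    mean≥j : 2 ^ n * j ≤ ∑ Xs (score r)
    mean≥j = *-cancelˡ-≤ 3 (begin
      3 * (2 ^ n * j)    ≡⟨ e₁ (2 ^ n) j ⟩
      2 ^ n * (3 * j)    ≤⟨ *-monoʳ-≤ (2 ^ n) 3j≤2n ⟩
      2 ^ n * (2 * n)    ≡⟨ e₂ (2 ^ n) n ⟩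
      2 * (2 ^ n * n)    ≤⟨ good ⟩
      3 * ∑ Xs (score r) ∎)
      where
      e₁ : ∀ P j → 3 * (P * j) ≡ P * (3 * j)
      e₁ = solve-∀
      e₂ : ∀ P n → P * (2 * n) ≡ 2 * (P * n)
      e₂ = solve-∀

^-*-≤ : ∀ {a b c} k → a * b ≤ c → a ^ k * b ^ k ≤ c ^ k
^-*-≤ zero    ab≤c = ≤-refl
^-*-≤ {a} {b} {c} (suc k) ab≤c = begin
  a * a ^ k * (b * b ^ k)    ≡⟨ interchange a b (a ^ k) (b ^ k) ⟩
  a * b * (a ^ k * b ^ k)    ≤⟨ *-mono-≤ ab≤c (^-*-≤ k ab≤c) ⟩
  c * c ^ k                  ∎
  where
  open ≤-Reasoning
  interchange : ∀ a b x y → a * x * (b * y) ≡ a * b * (x * y)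
  interchange = solve-∀

^-cancelˡ-≤ : ∀ m {a b} → 1 < m → m ^ a ≤ m ^ b → a ≤ b
^-cancelˡ-≤ m {a} {b} 1<m mᵃ≤mᵇ with a ≤? b
... | yes a≤b = a≤b
... | no  a≰b = contradiction mᵃ≤mᵇ (<⇒≱ (^-monoʳ-< m 1<m (≰⇒> a≰b)))

-- 2 · 3^15 = 28697814 ≤ 33554432 = 2^25.
2^q*3^[15q]≤2^[25q] : ∀ q → 2 ^ q * 3 ^ (15 * q) ≤ 2 ^ (25 * q)
2^q*3^[15q]≤2^[25q] q = subst₂ (λ t u → 2 ^ q * t ≤ u) (^-*-assoc 3 15 q) (^-*-assoc 2 25 q)
  (^-*-≤ q (≤ᵇ⇒≤ (2 * 3 ^ 15) (2 ^ 25) _))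

grouped-bound : ∀ q r s → 2 ^ (10 * q) * 2 ^ (15 * q + r) ≤ 2 ^ s * 3 ^ (15 * q + r) → q ≤ s + r
grouped-bound q r s hyp = +-cancelʳ-≤ r q (s + r)
  (subst (q + r ≤_) (e₃ s r) (^-cancelˡ-≤ 2 (s≤s (s≤s z≤n)) (*-cancelʳ-≤ _ _ X {{m^n≢0 3 (15 * q)}} (begin
    2 ^ (q + r) * X                 ≡⟨ cong (_* X) (^-distribˡ-+-* 2 q r) ⟩
    2 ^ q * 2 ^ r * X               ≡⟨ e₁ (2 ^ q) (2 ^ r) X ⟩
    2 ^ q * X * 2 ^ r               ≤⟨ *-monoˡ-≤ (2 ^ r) (2^q*3^[15q]≤2^[25q] q) ⟩
    2 ^ (25 * q) * 2 ^ r            ≡⟨ sym (^-distribˡ-+-* 2 (25 * q) r) ⟩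
    2 ^ (25 * q + r)                ≡⟨ cong (2 ^_) (e₂ q r) ⟩
    2 ^ (10 * q + (15 * q + r))     ≡⟨ ^-distribˡ-+-* 2 (10 * q) (15 * q + r) ⟩
    2 ^ (10 * q) * 2 ^ (15 * q + r) ≤⟨ hyp ⟩
    2 ^ s * 3 ^ (15 * q + r)        ≡⟨ cong (2 ^ s *_) (^-distribˡ-+-* 3 (15 * q) r) ⟩
    2 ^ s * (X * 3 ^ r)             ≤⟨ *-monoʳ-≤ (2 ^ s) (*-monoʳ-≤ X (^-monoˡ-≤ r (n≤1+n 3))) ⟩
    2 ^ s * (X * 4 ^ r)             ≡⟨ cong (λ t → 2 ^ s * (X * t)) (^-*-assoc 2 2 r) ⟩
    2 ^ s * (X * 2 ^ (2 * r))       ≡⟨ e₄ (2 ^ s) X (2 ^ (2 * r)) ⟩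
    2 ^ s * 2 ^ (2 * r) * X         ≡⟨ cong (_* X) (sym (^-distribˡ-+-* 2 s (2 * r))) ⟩
    2 ^ (s + 2 * r) * X             ∎))))
  where
  open ≤-Reasoning
  X = 3 ^ (15 * q)
  e₁ : ∀ a b c → a * b * c ≡ a * c * b
  e₁ = solve-∀
  e₂ : ∀ q r → 25 * q + r ≡ 10 * q + (15 * q + r)
  e₂ = solve-∀
  e₃ : ∀ s r → s + 2 * r ≡ s + r + r
  e₃ = solve-∀
  e₄ : ∀ a b c → a * (b * c) ≡ a * c * b
  e₄ = solve-∀

-- Take j = 10⌊n/15⌋: each block of 15 variables gains a factor 2^25 / 3^15 ≥ 2.
linear-bound : ∀ n s → ((j : ℕ) → 3 * j ≤ 2 * n → 2 ^ j * 2 ^ n ≤ 2 ^ s * 3 ^ n) → n ≤ 15 * s + 224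
linear-bound n s space = subst (_≤ 15 * s + 224) (sym n≡15q+r) (begin
  15 * q + r          ≤⟨ +-mono-≤ (*-monoʳ-≤ 15 q≤s+14) r≤14 ⟩
  15 * (s + 14) + 14  ≡⟨ e s ⟩
  15 * s + 224        ∎)
  where
  open ≤-Reasoning
  q = n / 15
  r = n % 15
  n≡15q+r : n ≡ 15 * q + r
  n≡15q+r = trans (m≡m%n+[m/n]*n n 15) (trans (+-comm r (q * 15)) (cong (_+ r) (*-comm q 15)))
  r≤14 : r ≤ 14
  r≤14 = ≤-pred (m%n<n n 15)
  3j≤2n : 3 * (10 * q) ≤ 2 * n
  3j≤2n = subst (λ t → 3 * (10 * q) ≤ 2 * t) (sym n≡15q+r)
    (≤-trans (≤-reflexive (e′ q)) (*-monoʳ-≤ 2 (m≤m+n (15 * q) r)))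
    where
    e′ : ∀ q → 3 * (10 * q) ≡ 2 * (15 * q)
    e′ = solve-∀
  q≤s+14 : q ≤ s + 14
  q≤s+14 = ≤-trans (grouped-bound q r s (subst (λ t → 2 ^ (10 * q) * 2 ^ t ≤ 2 ^ s * 3 ^ t) n≡15q+r
    (space (10 * q) 3j≤2n))) (+-monoʳ-≤ s r≤14)
  e : ∀ s → 15 * (s + 14) + 14 ≡ 15 * s + 224
  e = solve-∀

absorb-constant : ∀ {n} s → 225 ≤ n → n ≤ 15 * s + 224 → n ≤ 239 * s
absorb-constant zero    225≤n n≤224 = contradiction (≤-trans 225≤n n≤224) (<⇒≱ ≤-refl)
absorb-constant (suc s) _ n≤ = ≤-trans n≤ (begin
  15 * suc s + 224        ≡⟨ e₁ s ⟩
  239 + 15 * s            ≤⟨ m≤m+n (239 + 15 * s) (224 * s) ⟩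
  239 + 15 * s + 224 * s  ≡⟨ e₂ s ⟩
  239 * suc s             ∎)
  where
  open ≤-Reasoning
  e₁ : ∀ s → 15 * suc s + 224 ≡ 239 + 15 * s
  e₁ = solve-∀
  e₂ : ∀ s → 239 + 15 * s + 224 * s ≡ 239 * suc s
  e₂ = solve-∀

theorem6 : Σ ℕ λ c → Σ ℕ λ n₀ →
    (n : ℕ) → n₀ ≤ n → (s : ℕ) → (A : StreamAlg n s) → Decides A →
      n ≤ suc c * s
theorem6 = 238 , 225 , λ n 225≤n s 𝒜 decides →
  absorb-constant s 225≤n (linear-bound n s (space-lower-bound 𝒜 decides))
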